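{- Let $p$ be a prime, $k\ge 0$ an integer and $n\ge 1$ an integer, with $n>1$ if $p=2$. Then (1) $P\left(p,\,p^k(p^n-1)\right)=p^k(p^n-1)$; (2) $P\left(p,\,p^k(p^n+1)\right)=p^k(p^{2n}-1)$.
   Context: For positive integers $m,n$, let $\mathbf{Z}_m$ be the ring of integers modulo $m$ and define $T:\mathbf{Z}_m^n\to\mathbf{Z}_m^n$ by $T(a_0,\dots,a_{n-1})=(a_0+a_1,a_1+a_2,\dots,a_{n-2}+a_{n-1},a_{n-1}+a_0)$. For $\mathbf{a}\in\mathbf{Z}_m^n$, the cycle length of $(T^k\mathbf{a})_{k\ge0}$ is the smallest positive integer $P$ for which there exists $N$ with $T^{k+P}\mathbf{a}=T^k\mathbf{a}$ for all $k\ge N$. The period $P(m,n)$ is the maximum of these cycle lengths over all $\mathbf{a}\in\mathbf{Z}_m^n$. -}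

module Defs where

open import Data.Nat using (ℕ; zero; suc; _+_; _≤_; _<_)
open import Data.Nat.DivMod using (_mod_)
open import Data.Fin using (Fin; toℕ)
open import Data.Product using (Σ; _×_; ∃)
open import Relation.Binary.PropositionalEquality using (_≡_)
open import Relation.Nullary using (¬_)

-- States: elements of Z_m^n, as functions Fin n → Fin m (Fin m = Z_m).
State : ℕ → ℕ → Set
State m n = Fin n → Fin m

next : ∀ {n} → Fin n → Fin n
next {suc n} i = suc (toℕ i) mod suc n

T : ∀ {m n} → State m n → State m n
T {zero}  a i = a i
T {suc m} a i = (toℕ (a i) + toℕ (a (next i))) mod suc m

iterT : ∀ {m n} → ℕ → State m n → State m n
iterT zero    a = a
iterT (suc k) a = T (iterT k a)

_≈_ : ∀ {m n} → State m n → State m n → Set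
a ≈ b = ∀ i → a i ≡ b i

EventuallyPeriodic : ∀ {m n} → State m n → ℕ → Set
EventuallyPeriodic a P = Σ ℕ λ N → ∀ k → N ≤ k → iterT (k + P) a ≈ iterT k a

IsCycleLength : ∀ {m n} → State m n → ℕ → Set
IsCycleLength a P =
  (0 < P) × EventuallyPeriodic a P × (∀ Q → 0 < Q → Q < P → ¬ EventuallyPeriodic a Q)

-- P(m,n) = v : v is the maximum of the cycle lengths over all a ∈ Z_m^n
IsPeriod : ℕ → ℕ → ℕ → Set
IsPeriod m n v =
  (Σ (State m n) λ a → IsCycleLength a v) ×
  (∀ (a : State m n) c → IsCycleLength a c → c ≤ v)

-- Read a state as an N-periodic sequence g of naturals: T becomes Δ 1, where
-- Δ d g i = g i + g (i + d), taken modulo p.  Modulo p the binomial theorem gives the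
-- Frobenius identity Δ^ 1 (p ^ s) ≋ Δ (p ^ s), so whenever p ^ s + L = p ^ s′ with L a
-- multiple of N, every orbit is periodic with period L from step p ^ s on; with s = k
-- this gives the upper bounds.  Minimality is witnessed by the pulse δ at the
-- multiples of N: for m < N, Δ^ 1 m δ is 1 at 0 and at N ∸ m and 0 in between, so the
-- first N + 1 states of its orbit are distinct.  In case (1) the periods after p ^ k
-- are closed under N ∸ _, so a shorter one could be taken ≤ N / 2 and would identify
-- two of these states.  In case (2), with e = p ^ (k + n) and D = e ∸ p ^ k, D further
-- steps rotate any state after p ^ k by e; a shorter period Q = r + a * D would make
-- the state after p ^ k + r a rotation of Δ (p ^ k) δ, which the shape of Δ^ 1 m δ
-- forbids unless r = 0 and N ∣ a * e, i.e. p ^ n + 1 ∣ a < p ^ n + 1.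

module Submission where

open import Data.Empty using (⊥)
open import Data.Fin using (Fin; toℕ)
open import Data.Fin.Properties using (toℕ-injective; toℕ-fromℕ<; toℕ<n)
open import Data.Nat
open import Data.Nat.Combinatorics using (_C_; nCn≡1; nC1≡n; nCk+nC[k+1]≡[n+1]C[k+1])
open import Data.Nat.Divisibility
  using (_∣_; divides; >⇒∤; ∣m⇒∣m*n; ∣m+n∣m⇒∣n; n∣m*n; *-cancelˡ-∣; m%n≡0⇒n∣m; ∣⇒≤)
open import Data.Nat.DivMod
open import Data.Nat.GeneralisedArithmetic using (fold; fold-+)
open import Data.Nat.Primality using (Prime; euclidsLemma; prime⇒nonZero; prime⇒nonTrivial)
open import Data.Nat.Properties
open import Algebra.Properties.CommutativeSemigroup +-commutativeSemigroup using (xy∙z≈xz∙y)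
open import Data.Nat.Tactic.RingSolver using (solve-∀)
open import Data.Product using (Σ; _,_; _×_)
open import Data.Sum using (inj₁; inj₂)
open import Function.Base using (_∘_)
open import Level using (0ℓ)
open import Relation.Binary.Bundles using (Setoid)
open import Relation.Binary.Definitions using (tri<; tri≈; tri>)
open import Relation.Binary.PropositionalEquality
open import Relation.Nullary using (¬_; contradiction; yes; no)

open import Defs

-- Binomial coefficients and sums

∑ : ℕ → (ℕ → ℕ) → ℕ
∑ zero    f = 0
∑ (suc n) f = ∑ n f + f n

∑-cong : ∀ n {f g} → (∀ j → f j ≡ g j) → ∑ n f ≡ ∑ n g
∑-cong zero    f≡g = refl
∑-cong (suc n) f≡g = cong₂ _+_ (∑-cong n f≡g) (f≡g n)

[1+k]*[1+n]C[1+k]≡[1+n]*nCk : ∀ n k → suc k * (suc n C suc k) ≡ suc n * (n C k)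
[1+k]*[1+n]C[1+k]≡[1+n]*nCk zero    zero    = refl
[1+k]*[1+n]C[1+k]≡[1+n]*nCk zero    (suc k) = *-zeroʳ (2 + k)
[1+k]*[1+n]C[1+k]≡[1+n]*nCk (suc n) zero    = begin
  1 * (suc (suc n) C 1) ≡⟨ *-identityˡ _ ⟩
  suc (suc n) C 1       ≡⟨ nC1≡n (2 + n) ⟩
  2 + n                 ≡⟨ *-identityʳ (2 + n) ⟨
  (2 + n) * 1           ∎
  where open ≡-Reasoning
[1+k]*[1+n]C[1+k]≡[1+n]*nCk (suc n) (suc k) = begin
  (2 + k) * (suc (suc n) C suc (suc k))
    ≡⟨ cong ((2 + k) *_) (nCk+nC[k+1]≡[n+1]C[k+1] (suc n) (suc k)) ⟨
  (2 + k) * (c + suc n C suc (suc k))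
    ≡⟨ *-distribˡ-+ (2 + k) c _ ⟩
  c + (1 + k) * c + (2 + k) * (suc n C suc (suc k))
    ≡⟨ cong₂ (λ x y → c + x + y) ([1+k]*[1+n]C[1+k]≡[1+n]*nCk n k) ([1+k]*[1+n]C[1+k]≡[1+n]*nCk n (suc k)) ⟩
  c + (1 + n) * (n C k) + (1 + n) * (n C suc k)
    ≡⟨ +-assoc c _ _ ⟩
  c + ((1 + n) * (n C k) + (1 + n) * (n C suc k))
    ≡⟨ cong (c +_) (*-distribˡ-+ (1 + n) (n C k) _) ⟨
  c + (1 + n) * (n C k + n C suc k)
    ≡⟨ cong (λ x → c + (1 + n) * x) (nCk+nC[k+1]≡[n+1]C[k+1] n k) ⟩
  (2 + n) * c ∎
  where
  open ≡-Reasoning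
  c = suc n C suc k

p∣pCk : ∀ {p k} → Prime p → 0 < k → k < p → p ∣ p C k
p∣pCk {suc p} {suc k} p-prime _ k<p with euclidsLemma (suc k) (suc p C suc k) p-prime
  (divides (p C k) (trans ([1+k]*[1+n]C[1+k]≡[1+n]*nCk p k) (*-comm (suc p) (p C k))))
... | inj₁ p∣1+k = contradiction p∣1+k (>⇒∤ k<p)
... | inj₂ p∣pCk = p∣pCk

∑-pascal : ∀ m (h : ℕ → ℕ) B →
  ∑ (suc B) (λ j → (suc m C j) * h j) ≡ ∑ (suc B) (λ j → (m C j) * h j) + ∑ B (λ j → (m C j) * h (suc j))
∑-pascal m h zero    = sym (+-identityʳ _)
∑-pascal m h (suc B) = begin
  ∑ (suc B) (λ j → (suc m C j) * h j) + (suc m C suc B) * h (suc B)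
    ≡⟨ cong₂ _+_ (∑-pascal m h B) (cong (_* h (suc B)) (sym (nCk+nC[k+1]≡[n+1]C[k+1] m B))) ⟩
  (S + S′) + (m C B + m C suc B) * h (suc B)
    ≡⟨ regroup S S′ (m C B) (m C suc B) (h (suc B)) ⟩
  (S + (m C suc B) * h (suc B)) + (S′ + (m C B) * h (suc B)) ∎
  where
  open ≡-Reasoning
  S  = ∑ (suc B) (λ j → (m C j) * h j)
  S′ = ∑ B (λ j → (m C j) * h (suc j))
  regroup : ∀ a b x y z → (a + b) + (x + y) * z ≡ (a + y * z) + (b + x * z)
  regroup = solve-∀

∑0Cjhj≡h0 : ∀ B (h : ℕ → ℕ) → ∑ (suc B) (λ j → (0 C j) * h j) ≡ h 0
∑0Cjhj≡h0 zero    h = +-identityʳ (h 0)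
∑0Cjhj≡h0 (suc B) h = trans (+-identityʳ _) (∑0Cjhj≡h0 B h)

-- Difference operators and periodic sequences

Seq : Set
Seq = ℕ → ℕ

Δ : ℕ → Seq → Seq
Δ d g i = g i + g (i + d)

Δ^ : ℕ → ℕ → Seq → Seq
Δ^ d m g = fold g (Δ d) m

Δ^-binomial : ∀ d m g i {B} → m < B → Δ^ d m g i ≡ ∑ B (λ j → (m C j) * g (i + j * d))
Δ^-binomial d zero    g i {suc B} _ = sym (trans (∑0Cjhj≡h0 B _) (cong g (+-identityʳ i)))
Δ^-binomial d (suc m) g i {suc B} (s≤s m<B) = begin
  Δ^ d m g i + Δ^ d m g (i + d)
    ≡⟨ cong₂ _+_ (Δ^-binomial d m g i (m<n⇒m<1+n m<B)) (Δ^-binomial d m g (i + d) m<B) ⟩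
  ∑ (suc B) (λ j → (m C j) * h j) + ∑ B (λ j → (m C j) * g (i + d + j * d))
    ≡⟨ cong (∑ (suc B) (λ j → (m C j) * h j) +_) (∑-cong B (λ j → cong (λ x → (m C j) * g x) (+-assoc i d (j * d)))) ⟩
  ∑ (suc B) (λ j → (m C j) * h j) + ∑ B (λ j → (m C j) * h (suc j))
    ≡⟨ ∑-pascal m h B ⟨
  ∑ (suc B) (λ j → (suc m C j) * h j) ∎
  where
  open ≡-Reasoning
  h : ℕ → ℕ
  h j = g (i + j * d)

Periodic : ℕ → Seq → Set
Periodic N g = ∀ i → g (i + N) ≡ g i

Δ-periodic : ∀ {N} d {g} → Periodic N g → Periodic N (Δ d g)
Δ-periodic {N} d {g} g-per i =
  cong₂ _+_ (g-per i) (trans (cong g (xy∙z≈xz∙y i N d)) (g-per (i + d)))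

Δ^-periodic : ∀ {N} d m {g} → Periodic N g → Periodic N (Δ^ d m g)
Δ^-periodic d zero    g-per = g-per
Δ^-periodic d (suc m) g-per = Δ-periodic d (Δ^-periodic d m g-per)

periodic-* : ∀ {N g} → Periodic N g → ∀ q i → g (i + q * N) ≡ g i
periodic-* {N} {g} g-per zero    i = cong g (+-identityʳ i)
periodic-* {N} {g} g-per (suc q) i = begin
  g (i + (N + q * N))   ≡⟨ cong g (trans (cong (i +_) (+-comm N (q * N))) (sym (+-assoc i (q * N) N))) ⟩
  g (i + q * N + N)     ≡⟨ g-per (i + q * N) ⟩
  g (i + q * N)         ≡⟨ periodic-* g-per q i ⟩
  g i                   ∎
  where open ≡-Reasoning

periodic-% : ∀ {N g} .{{_ : NonZero N}} → Periodic N g → ∀ i → g (i % N) ≡ g i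
periodic-% {N} {g} g-per i =
  trans (sym (periodic-* g-per (i / N) (i % N))) (cong g (sym (m≡m%n+[m/n]*n i N)))

shift : ℕ → Seq → Seq
shift s g i = g (i + s)

Δ^-shift : ∀ d m s g i → Δ^ d m (shift s g) i ≡ Δ^ d m g (i + s)
Δ^-shift d zero    s g i = refl
Δ^-shift d (suc m) s g i = cong₂ _+_ (Δ^-shift d m s g i)
  (trans (Δ^-shift d m s g (i + d)) (cong (Δ^ d m g) (xy∙z≈xz∙y i d s)))

periodic-shift-% : ∀ {N g} .{{_ : NonZero N}} → Periodic N g → ∀ s i → g (i + s) ≡ g (i + s % N)
periodic-shift-% {N} {g} g-periodic s i = begin
  g (i + s)                          ≡⟨ cong (λ k → g (i + k)) (m≡m%n+[m/n]*n s N) ⟩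
  g (i + (s % N + s / N * N))        ≡⟨ cong g (+-assoc i (s % N) _) ⟨
  g (i + s % N + s / N * N)          ≡⟨ periodic-* g-periodic (s / N) (i + s % N) ⟩
  g (i + s % N)                      ∎
  where open ≡-Reasoning

Δ-complement : ∀ {N g u e} → Periodic N g → u + e ≡ N → ∀ i → Δ e g i ≡ shift e (Δ u g) i
Δ-complement {N} {g} {u} {e} g-periodic u+e≡N i = begin
  g i + g (i + e)              ≡⟨ +-comm (g i) _ ⟩
  g (i + e) + g i              ≡⟨ cong (g (i + e) +_) (g-periodic i) ⟨
  g (i + e) + g (i + N)        ≡⟨ cong (λ k → g (i + e) + g (i + k)) (trans (+-comm e u) u+e≡N) ⟨
  g (i + e) + g (i + (e + u))  ≡⟨ cong (λ k → g (i + e) + g k) (+-assoc i e u) ⟨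
  g (i + e) + g (i + e + u)    ∎
  where open ≡-Reasoning

module Congruence (p : ℕ) .{{_ : NonZero p}} where

  infix 4 _≋_
  record _≋_ (f g : Seq) : Set where
    constructor mk≋
    field at : ∀ i → f i % p ≡ g i % p
  open _≋_ public

  ≋-refl : ∀ {f} → f ≋ f
  ≋-refl = mk≋ λ _ → refl

  ≋-sym : ∀ {f g} → f ≋ g → g ≋ f
  ≋-sym f≋g = mk≋ λ i → sym (at f≋g i)

  ≋-trans : ∀ {f g h} → f ≋ g → g ≋ h → f ≋ h
  ≋-trans f≋g g≋h = mk≋ λ i → trans (at f≋g i) (at g≋h i)

  ≋-setoid : Setoid 0ℓ 0ℓ
  ≋-setoid = record
    { Carrier = Seq ; _≈_ = _≋_
    ; isEquivalence = record { refl = ≋-refl ; sym = ≋-sym ; trans = ≋-trans } }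

  ≡⇒≋ : ∀ {f g} → (∀ i → f i ≡ g i) → f ≋ g
  ≡⇒≋ f≡g = mk≋ λ i → cong (_% p) (f≡g i)

  +-cong-% : ∀ {a b c d} → a % p ≡ c % p → b % p ≡ d % p → (a + b) % p ≡ (c + d) % p
  +-cong-% {a} {b} {c} {d} a≡c b≡d = begin
    (a + b) % p             ≡⟨ %-distribˡ-+ a b p ⟩
    (a % p + b % p) % p     ≡⟨ cong₂ (λ x y → (x + y) % p) a≡c b≡d ⟩
    (c % p + d % p) % p     ≡⟨ %-distribˡ-+ c d p ⟨
    (c + d) % p             ∎
    where open ≡-Reasoning

  Δ-cong : ∀ d {f g} → f ≋ g → Δ d f ≋ Δ d g
  Δ-cong d f≋g = mk≋ λ i → +-cong-% (at f≋g i) (at f≋g (i + d))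

  Δ^-cong : ∀ d m {f g} → f ≋ g → Δ^ d m f ≋ Δ^ d m g
  Δ^-cong d zero    f≋g = f≋g
  Δ^-cong d (suc m) f≋g = Δ-cong d (Δ^-cong d m f≋g)

  EventuallyPeriodicΔ : Seq → ℕ → Set
  EventuallyPeriodicΔ g P = Σ ℕ λ K → ∀ k → K ≤ k → Δ^ 1 (k + P) g ≋ Δ^ 1 k g

  PeriodicFrom : ℕ → Seq → ℕ → Set
  PeriodicFrom u g P = Δ^ 1 (u + P) g ≋ Δ^ 1 u g

  periodicFrom⇒eventuallyPeriodic : ∀ {u g P} → PeriodicFrom u g P →
    ∀ k → u ≤ k → Δ^ 1 (k + P) g ≋ Δ^ 1 k g
  periodicFrom⇒eventuallyPeriodic {u} {g} {P} period k u≤k = begin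
    Δ^ 1 (k + P) g                    ≡⟨ cong (λ j → Δ^ 1 (j + P) g) (m∸n+n≡m u≤k) ⟨
    Δ^ 1 ((k ∸ u) + u + P) g          ≡⟨ cong (λ j → Δ^ 1 j g) (+-assoc (k ∸ u) u P) ⟩
    Δ^ 1 ((k ∸ u) + (u + P)) g        ≡⟨ fold-+ g (Δ 1) (k ∸ u) ⟩
    Δ^ 1 (k ∸ u) (Δ^ 1 (u + P) g)     ≈⟨ Δ^-cong 1 (k ∸ u) period ⟩
    Δ^ 1 (k ∸ u) (Δ^ 1 u g)           ≡⟨ fold-+ g (Δ 1) (k ∸ u) ⟨
    Δ^ 1 ((k ∸ u) + u) g              ≡⟨ cong (λ j → Δ^ 1 j g) (m∸n+n≡m u≤k) ⟩
    Δ^ 1 k g                          ∎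
    where open import Relation.Binary.Reasoning.Setoid ≋-setoid

  periodicFrom-* : ∀ {u g L} → PeriodicFrom u g L → ∀ t {j} → u ≤ j → Δ^ 1 (j + t * L) g ≋ Δ^ 1 j g
  periodicFrom-* {u} {g} {L} period zero    {j} _   = ≡⇒≋ λ i → cong (λ k → Δ^ 1 k g i) (+-identityʳ j)
  periodicFrom-* {u} {g} {L} period (suc t) {j} u≤j = begin
    Δ^ 1 (j + (L + t * L)) g
      ≡⟨ cong (λ k → Δ^ 1 k g) (trans (cong (j +_) (+-comm L (t * L))) (sym (+-assoc j (t * L) L))) ⟩
    Δ^ 1 (j + t * L + L) g
      ≈⟨ periodicFrom⇒eventuallyPeriodic period (j + t * L) (≤-trans u≤j (m≤m+n j (t * L))) ⟩
    Δ^ 1 (j + t * L) g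
      ≈⟨ periodicFrom-* {u} {g} {L} period t u≤j ⟩
    Δ^ 1 j g ∎
    where open import Relation.Binary.Reasoning.Setoid ≋-setoid

  eventuallyPeriodic⇒periodicFrom : ∀ {u g L Q} → 0 < L → PeriodicFrom u g L →
    EventuallyPeriodicΔ g Q → PeriodicFrom u g Q
  eventuallyPeriodic⇒periodicFrom {u} {g} {L} {Q} 0<L period (K , periodQ) = begin
    Δ^ 1 (u + Q) g
      ≈⟨ periodicFrom-* {u} {g} {L} period K (m≤m+n u Q) ⟨
    Δ^ 1 (u + Q + K * L) g
      ≡⟨ cong (λ k → Δ^ 1 k g) (xy∙z≈xz∙y u Q (K * L)) ⟩
    Δ^ 1 (u + K * L + Q) g
      ≈⟨ periodQ (u + K * L) (≤-trans (m≤m*n K L {{>-nonZero 0<L}}) (m≤n+m (K * L) u)) ⟩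
    Δ^ 1 (u + K * L) g
      ≈⟨ periodicFrom-* {u} {g} {L} period K ≤-refl ⟩
    Δ^ 1 u g ∎
    where open import Relation.Binary.Reasoning.Setoid ≋-setoid

  periodicFrom-∸ : ∀ {u g L Q} → PeriodicFrom u g L → PeriodicFrom u g Q → Q ≤ L → PeriodicFrom u g (L ∸ Q)
  periodicFrom-∸ {u} {g} {L} {Q} periodL periodQ Q≤L = begin
    Δ^ 1 (u + (L ∸ Q)) g
      ≈⟨ periodicFrom⇒eventuallyPeriodic periodQ (u + (L ∸ Q)) (m≤m+n u (L ∸ Q)) ⟨
    Δ^ 1 (u + (L ∸ Q) + Q) g
      ≡⟨ cong (λ k → Δ^ 1 k g) (trans (+-assoc u (L ∸ Q) Q) (cong (u +_) (m∸n+n≡m Q≤L))) ⟩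
    Δ^ 1 (u + L) g
      ≈⟨ periodL ⟩
    Δ^ 1 u g ∎
    where open import Relation.Binary.Reasoning.Setoid ≋-setoid

  shift-cong : ∀ s {f g} → f ≋ g → shift s f ≋ shift s g
  shift-cong s f≋g = mk≋ λ i → at f≋g (i + s)

  shiftedFrom-* : ∀ {u g D e} → Δ^ 1 (u + D) g ≋ shift e (Δ^ 1 u g) →
    ∀ a t → Δ^ 1 (u + t + a * D) g ≋ shift (a * e) (Δ^ 1 (u + t) g)
  shiftedFrom-* {u} {g} {D} {e} rotation zero t =
    ≡⇒≋ λ i → cong₂ (λ j k → Δ^ 1 j g k) (+-identityʳ (u + t)) (sym (+-identityʳ i))
  shiftedFrom-* {u} {g} {D} {e} rotation (suc a) t = begin
    Δ^ 1 (u + t + (D + a * D)) g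
      ≡⟨ cong (λ j → Δ^ 1 j g) (reassoc u t D (a * D)) ⟩
    Δ^ 1 ((t + a * D) + (u + D)) g
      ≡⟨ fold-+ g (Δ 1) (t + a * D) ⟩
    Δ^ 1 (t + a * D) (Δ^ 1 (u + D) g)
      ≈⟨ Δ^-cong 1 (t + a * D) rotation ⟩
    Δ^ 1 (t + a * D) (shift e (Δ^ 1 u g))
      ≈⟨ ≡⇒≋ (Δ^-shift 1 (t + a * D) e (Δ^ 1 u g)) ⟩
    shift e (Δ^ 1 (t + a * D) (Δ^ 1 u g))
      ≡⟨ cong (shift e) (trans (cong (λ j → Δ^ 1 j g) (trans (+-assoc u t (a * D)) (+-comm u _))) (fold-+ g (Δ 1) (t + a * D))) ⟨
    shift e (Δ^ 1 (u + t + a * D) g)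
      ≈⟨ shift-cong e (shiftedFrom-* {u} {g} {D} {e} rotation a t) ⟩
    shift e (shift (a * e) (Δ^ 1 (u + t) g))
      ≈⟨ ≡⇒≋ (λ i → cong (Δ^ 1 (u + t) g) (+-assoc i e (a * e))) ⟩
    shift (e + a * e) (Δ^ 1 (u + t) g) ∎
    where
    open import Relation.Binary.Reasoning.Setoid ≋-setoid
    reassoc : ∀ u t D aD → u + t + (D + aD) ≡ (t + aD) + (u + D)
    reassoc = solve-∀

  eventuallyPeriodic-resp : ∀ {f g P} → f ≋ g → EventuallyPeriodicΔ f P → EventuallyPeriodicΔ g P
  eventuallyPeriodic-resp {f} {g} {P} f≋g (K , period) = K , λ k K≤k →
    ≋-trans (Δ^-cong 1 (k + P) (≋-sym f≋g)) (≋-trans (period k K≤k) (Δ^-cong 1 k f≋g))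

module Frobenius {p} (p-prime : Prime p) where

  private instance
    p≢0 : NonZero p
    p≢0 = prime⇒nonZero p-prime

  open Congruence p

  ∑pCjhj%p≡h0%p : ∀ (h : ℕ → ℕ) {t} → 0 < t → t ≤ p → ∑ t (λ j → (p C j) * h j) % p ≡ h 0 % p
  ∑pCjhj%p≡h0%p h {suc zero}    _ _ = cong (_% p) (+-identityʳ (h 0))
  ∑pCjhj%p≡h0%p h {suc (suc t)} _ t<p = trans
    (%-remove-+ʳ _ (∣m⇒∣m*n (h (suc t)) (p∣pCk p-prime z<s t<p)))
    (∑pCjhj%p≡h0%p h z<s (<⇒≤ t<p))

  frobenius : ∀ d g → Δ^ d p g ≋ Δ (p * d) g
  frobenius d g = mk≋ λ i → begin
    Δ^ d p g i % p
      ≡⟨ cong (_% p) (Δ^-binomial d p g i ≤-refl) ⟩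
    (∑ p (λ j → (p C j) * h i j) + (p C p) * h i p) % p
      ≡⟨ +-cong-% (∑pCjhj%p≡h0%p (h i) (>-nonZero⁻¹ p) ≤-refl) (cong (λ c → c * h i p % p) (nCn≡1 p)) ⟩
    (h i 0 + 1 * h i p) % p
      ≡⟨ cong₂ (λ x y → (g x + y) % p) (+-identityʳ i) (*-identityˡ (h i p)) ⟩
    Δ (p * d) g i % p ∎
    where
    open ≡-Reasoning
    h : ℕ → ℕ → ℕ
    h i j = g (i + j * d)

  frobenius-* : ∀ d m g → Δ^ d (p * m) g ≋ Δ^ (p * d) m g
  frobenius-* d zero    g = ≡⇒≋ λ i → cong (λ k → Δ^ d k g i) (*-zeroʳ p)
  frobenius-* d (suc m) g = begin
    Δ^ d (p * suc m) g              ≡⟨ cong (λ k → Δ^ d k g) (*-suc p m) ⟩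
    Δ^ d (p + p * m) g              ≡⟨ fold-+ g (Δ d) p ⟩
    Δ^ d p (Δ^ d (p * m) g)         ≈⟨ frobenius d _ ⟩
    Δ (p * d) (Δ^ d (p * m) g)      ≈⟨ Δ-cong (p * d) (frobenius-* d m g) ⟩
    Δ^ (p * d) (suc m) g            ∎
    where open import Relation.Binary.Reasoning.Setoid ≋-setoid

  frobenius-^ : ∀ s d g → Δ^ d (p ^ s) g ≋ Δ (p ^ s * d) g
  frobenius-^ zero    d g = ≡⇒≋ λ i → cong (λ k → Δ k g i) (sym (+-identityʳ d))
  frobenius-^ (suc s) d g = begin
    Δ^ d (p * p ^ s) g       ≈⟨ frobenius-* d (p ^ s) g ⟩
    Δ^ (p * d) (p ^ s) g     ≈⟨ frobenius-^ s (p * d) g ⟩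
    Δ (p ^ s * (p * d)) g    ≡⟨ cong (λ k → Δ k g) (x∙yz≈yx∙z (p ^ s) p d) ⟩
    Δ (p * p ^ s * d) g      ∎
    where
    open import Relation.Binary.Reasoning.Setoid ≋-setoid
    x∙yz≈yx∙z : ∀ a b c → a * (b * c) ≡ b * a * c
    x∙yz≈yx∙z = solve-∀

  frobenius-^₁ : ∀ s g → Δ^ 1 (p ^ s) g ≋ Δ (p ^ s) g
  frobenius-^₁ s g = ≋-trans (frobenius-^ s 1 g) (≡⇒≋ λ i → cong (λ k → Δ k g i) (*-identityʳ (p ^ s)))

  periodicFrom-^ : ∀ {L g} s s′ → p ^ s + L ≡ p ^ s′ → Periodic L g → PeriodicFrom (p ^ s) g L
  periodicFrom-^ {L} {g} s s′ p^s+L≡p^s′ g-periodic = begin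
    Δ^ 1 (p ^ s + L) g    ≡⟨ cong (λ k → Δ^ 1 k g) p^s+L≡p^s′ ⟩
    Δ^ 1 (p ^ s′) g       ≈⟨ frobenius-^₁ s′ g ⟩
    Δ (p ^ s′) g          ≈⟨ ≡⇒≋ (λ i → cong (g i +_) (g[i+p^s′]≡g[i+p^s] i)) ⟩
    Δ (p ^ s) g           ≈⟨ frobenius-^₁ s g ⟨
    Δ^ 1 (p ^ s) g        ∎
    where
    open import Relation.Binary.Reasoning.Setoid ≋-setoid
    g[i+p^s′]≡g[i+p^s] : ∀ i → g (i + p ^ s′) ≡ g (i + p ^ s)
    g[i+p^s′]≡g[i+p^s] i = trans (cong (λ k → g (i + k)) (sym p^s+L≡p^s′))
      (trans (cong g (sym (+-assoc i (p ^ s) L))) (g-periodic (i + p ^ s)))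

-- The pulse at the multiples of N

δ₀ : ℕ → ℕ
δ₀ zero    = 1
δ₀ (suc _) = 0

pulse : (N : ℕ) .{{_ : NonZero N}} → Seq
pulse N i = δ₀ (i % N)

module _ {N : ℕ} .{{_ : NonZero N}} where

  pulse-periodic : Periodic N (pulse N)
  pulse-periodic i = cong δ₀ ([m+n]%n≡m%n i N)

  pulse-0 : pulse N 0 ≡ 1
  pulse-0 = cong δ₀ (m<n⇒m%n≡m (>-nonZero⁻¹ N))

  pulse-N : pulse N N ≡ 1
  pulse-N = cong δ₀ (n%n≡0 N)

  pulse-inner : ∀ {i} → 0 < i → i < N → pulse N i ≡ 0
  pulse-inner {suc i} _ i<N = cong δ₀ (m<n⇒m%n≡m i<N)

  pulse-off : ∀ {i} → 0 < i → i < N + N → i ≢ N → pulse N i ≡ 0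
  pulse-off {i} 0<i i<2N i≢N with <-cmp i N
  ... | tri< i<N _ _ = pulse-inner 0<i i<N
  ... | tri≈ _ i≡N _ = contradiction i≡N i≢N
  ... | tri> _ _ N<i = begin
    pulse N i                ≡⟨ cong (pulse N) (m∸n+n≡m (<⇒≤ N<i)) ⟨
    pulse N (i ∸ N + N)      ≡⟨ pulse-periodic (i ∸ N) ⟩
    pulse N (i ∸ N)          ≡⟨ pulse-inner (m<n⇒0<n∸m N<i) (+-cancelʳ-< N (i ∸ N) N i∸N+N<N+N) ⟩
    0                        ∎
    where
    open ≡-Reasoning
    i∸N+N<N+N : i ∸ N + N < N + N
    i∸N+N<N+N = subst (_< N + N) (sym (m∸n+n≡m (<⇒≤ N<i))) i<2N

  Δ^-pulse-inner : ∀ m {i} → 0 < i → i + m < N → Δ^ 1 m (pulse N) i ≡ 0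
  Δ^-pulse-inner zero    {i} 0<i i+0<N = pulse-inner 0<i (subst (_< N) (+-identityʳ i) i+0<N)
  Δ^-pulse-inner (suc m) {i} 0<i i+1+m<N = cong₂ _+_
    (Δ^-pulse-inner m 0<i (<-trans (+-monoʳ-< i (n<1+n m)) i+1+m<N))
    (Δ^-pulse-inner m (m≤n+m 1 i) (subst (_< N) (sym (+-assoc i 1 m)) i+1+m<N))

  Δ^-pulse-0 : ∀ m → m < N → Δ^ 1 m (pulse N) 0 ≡ 1
  Δ^-pulse-0 zero    _   = pulse-0
  Δ^-pulse-0 (suc m) m<N = cong₂ _+_ (Δ^-pulse-0 m (<-trans (n<1+n m) m<N)) (Δ^-pulse-inner m z<s m<N)

  Δ^-pulse-edge : ∀ m {i} → 0 < i → i + m ≡ N → Δ^ 1 m (pulse N) i ≡ 1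
  Δ^-pulse-edge zero    {i} _   i+0≡N = trans (cong (pulse N) (trans (sym (+-identityʳ i)) i+0≡N)) pulse-N
  Δ^-pulse-edge (suc m) {i} 0<i i+1+m≡N = cong₂ _+_
    (Δ^-pulse-inner m 0<i (subst (i + m <_) i+1+m≡N (+-monoʳ-< i (n<1+n m))))
    (Δ^-pulse-edge m (m≤n+m 1 i) (trans (+-assoc i 1 m) i+1+m≡N))

  Δ^-pulse-N : ∀ m → suc m ≡ N → Δ^ 1 (suc m) (pulse N) 0 ≡ 2
  Δ^-pulse-N m 1+m≡N =
    cong₂ _+_ (Δ^-pulse-0 m (subst (m <_) 1+m≡N (n<1+n m))) (Δ^-pulse-edge m z<s 1+m≡N)

1%n≢0%n : ∀ n .{{_ : NonZero n}} .{{_ : NonTrivial n}} → 1 % n ≢ 0 % n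
1%n≢0%n (suc (suc n)) ()

2%n≢1%n : ∀ n .{{_ : NonZero n}} .{{_ : NonTrivial n}} → 2 % n ≢ 1 % n
2%n≢1%n 2                   ()
2%n≢1%n (suc (suc (suc n))) ()

module _ {p N : ℕ} .{{_ : NonTrivial p}} .{{_ : NonZero N}} where

  private instance
    p≢0 : NonZero p
    p≢0 = nonTrivial⇒nonZero p

  open Congruence p

  Δ^-pulse-injective : ∀ {m m′} → m′ < m → m ≤ N → ¬ (Δ^ 1 m (pulse N) ≋ Δ^ 1 m′ (pulse N))
  Δ^-pulse-injective {suc m} {m′} m′<m m≤N eq with m≤n⇒m<n∨m≡n m≤N
  ... | inj₁ m<N = 1%n≢0%n p (begin
    1 % p
      ≡⟨ cong (_% p) (Δ^-pulse-edge (suc m) (m<n⇒0<n∸m m<N) i+m≡N) ⟨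
    Δ^ 1 (suc m) (pulse N) i % p
      ≡⟨ at eq i ⟩
    Δ^ 1 m′ (pulse N) i % p
      ≡⟨ cong (_% p) (Δ^-pulse-inner m′ (m<n⇒0<n∸m m<N) (subst (i + m′ <_) i+m≡N (+-monoʳ-< i m′<m))) ⟩
    0 % p ∎)
    where
    open ≡-Reasoning
    i = N ∸ suc m
    i+m≡N : i + suc m ≡ N
    i+m≡N = m∸n+n≡m (<⇒≤ m<N)
  ... | inj₂ m≡N = 2%n≢1%n p (begin
    2 % p                         ≡⟨ cong (_% p) (Δ^-pulse-N m m≡N) ⟨
    Δ^ 1 (suc m) (pulse N) 0 % p  ≡⟨ at eq 0 ⟩
    Δ^ 1 m′ (pulse N) 0 % p       ≡⟨ cong (_% p) (Δ^-pulse-0 m′ (<-≤-trans m′<m m≤N)) ⟩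
    1 % p                         ∎)
    where open ≡-Reasoning

  Δ^-pulse≉Δ : ∀ {u m} → u < m → m < N → ¬ (Δ^ 1 m (pulse N) ≋ Δ u (pulse N))
  Δ^-pulse≉Δ {u} {m} u<m m<N eq = 1%n≢0%n p (begin
    1 % p
      ≡⟨ cong (_% p) (Δ^-pulse-edge m 0<i i+m≡N) ⟨
    Δ^ 1 m (pulse N) i % p
      ≡⟨ at eq i ⟩
    Δ u (pulse N) i % p
      ≡⟨ cong (_% p) (cong₂ _+_ (pulse-inner 0<i i<N) (pulse-inner (<-≤-trans 0<i (m≤m+n i u)) i+u<N)) ⟩
    0 % p ∎)
    where
    open ≡-Reasoning
    i = N ∸ m
    i+m≡N : i + m ≡ N
    i+m≡N = m∸n+n≡m (<⇒≤ m<N)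
    0<i : 0 < i
    0<i = m<n⇒0<n∸m m<N
    i+u<N : i + u < N
    i+u<N = subst (i + u <_) i+m≡N (+-monoʳ-< i u<m)
    i<N : i < N
    i<N = ≤-<-trans (m≤m+n i u) i+u<N

  pulse≡1-mod⇒≡N : ∀ {x} → 0 < x → x < N + N → pulse N x % p ≡ 1 % p → x ≡ N
  pulse≡1-mod⇒≡N {x} 0<x x<2N pulse≡1 with x ≟ N
  ... | yes x≡N = x≡N
  ... | no  x≢N = contradiction (trans (sym pulse≡1) (cong (_% p) (pulse-off 0<x x<2N x≢N))) (1%n≢0%n p)

  shift-Δ^-pulse≋Δ⇒≡ : ∀ {u m t} → 0 < u → 0 < t → t < N → m < N → u < N →
    shift t (Δ^ 1 m (pulse N)) ≋ Δ u (pulse N) → t ≡ u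
  shift-Δ^-pulse≋Δ⇒≡ {u} {m} {t} 0<u 0<t t<N m<N u<N eq =
    +-cancelˡ-≡ i t u (trans i+t≡N (sym (pulse≡1-mod⇒≡N (<-≤-trans 0<u (m≤n+m u i)) (+-mono-< i<N u<N) pulse[i+u]≡1)))
    where
    open ≡-Reasoning
    G = Δ^ 1 m (pulse N)
    i = N ∸ t
    i+t≡N : i + t ≡ N
    i+t≡N = m∸n+n≡m (<⇒≤ t<N)
    i<N : i < N
    i<N = ∸-monoʳ-< 0<t (<⇒≤ t<N)
    pulse[i+u]≡1 : pulse N (i + u) % p ≡ 1 % p
    pulse[i+u]≡1 = sym (begin
      1 % p
        ≡⟨ cong (_% p) (Δ^-pulse-0 m m<N) ⟨
      G 0 % p
        ≡⟨ cong (_% p) (Δ^-periodic 1 m pulse-periodic 0) ⟨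
      G N % p
        ≡⟨ cong (λ k → G k % p) i+t≡N ⟨
      G (i + t) % p
        ≡⟨ at eq i ⟩
      (pulse N i + pulse N (i + u)) % p
        ≡⟨ cong (λ k → (k + pulse N (i + u)) % p) (pulse-inner (m<n⇒0<n∸m t<N) i<N) ⟩
      pulse N (i + u) % p ∎)

  shift-Δ^-pulse≉Δ : ∀ {u e m t} → u + e ≡ N → 0 < u → u ≤ m → m < e → 0 < t → t < N →
    ¬ (shift t (Δ^ 1 m (pulse N)) ≋ Δ u (pulse N))
  shift-Δ^-pulse≉Δ {u} {e} {m} {t} u+e≡N 0<u u≤m m<e 0<t t<N eq = 1%n≢0%n p (begin
    1 % p
      ≡⟨ cong (_% p) (Δ^-pulse-edge m (<-≤-trans 0<u (m≤n+m u j)) j+u+m≡N) ⟨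
    G (j + u) % p
      ≡⟨ cong (λ s → G (j + s) % p) t≡u ⟨
    G (j + t) % p
      ≡⟨ at eq j ⟩
    Δ u (pulse N) j % p
      ≡⟨ cong (_% p) (cong₂ _+_ (pulse-inner 0<j j<N) (pulse-inner (<-≤-trans 0<u (m≤n+m u j)) j+u<N)) ⟩
    0 % p ∎)
    where
    open ≡-Reasoning
    G = Δ^ 1 m (pulse N)
    e<N : e < N
    e<N = subst (e <_) u+e≡N (m<n+m e 0<u)
    m<N : m < N
    m<N = <-trans m<e e<N
    t≡u : t ≡ u
    t≡u = shift-Δ^-pulse≋Δ⇒≡ 0<u 0<t t<N m<N (≤-<-trans u≤m m<N) eq
    j = e ∸ m
    j+u+m≡N : j + u + m ≡ N
    j+u+m≡N = trans (xy∙z≈xz∙y j u m) (trans (cong (_+ u) (m∸n+n≡m (<⇒≤ m<e))) (trans (+-comm e u) u+e≡N))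
    0<j : 0 < j
    0<j = m<n⇒0<n∸m m<e
    j<N : j < N
    j<N = <-trans (∸-monoʳ-< (<-≤-trans 0<u u≤m) (<⇒≤ m<e)) e<N
    j+u<N : j + u < N
    j+u<N = subst (j + u <_) j+u+m≡N (m<m+n (j + u) (<-≤-trans 0<u u≤m))

-- States as periodic sequences

toℕ-mod : ∀ {n} .{{_ : NonZero n}} i → toℕ (i mod n) ≡ i % n
toℕ-mod {n} i = toℕ-fromℕ< (m%n<n i n)

toℕ-next : ∀ {N} .{{_ : NonZero N}} (j : Fin N) → toℕ (next j) ≡ suc (toℕ j) % N
toℕ-next {suc N} j = toℕ-mod (suc (toℕ j))

toℕ-T : ∀ {p N} .{{_ : NonZero p}} (a : State p N) j → toℕ (T a j) ≡ (toℕ (a j) + toℕ (a (next j))) % p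
toℕ-T {suc p} a j = toℕ-mod (toℕ (a j) + toℕ (a (next j)))

module _ {p N : ℕ} .{{_ : NonZero p}} .{{_ : NonZero N}} where

  open Congruence p

  lift : State p N → Seq
  lift a i = toℕ (a (i mod N))

  ofSeq : Seq → State p N
  ofSeq g j = g (toℕ j) mod p

  lift-periodic : ∀ a → Periodic N (lift a)
  lift-periodic a i = cong (toℕ ∘ a) (toℕ-injective (begin
    toℕ ((i + N) mod N)  ≡⟨ toℕ-mod (i + N) ⟩
    (i + N) % N          ≡⟨ [m+n]%n≡m%n i N ⟩
    i % N                ≡⟨ toℕ-mod i ⟨
    toℕ (i mod N)        ∎))
    where open ≡-Reasoning

  lift-ofSeq : ∀ {g} → Periodic N g → lift (ofSeq g) ≋ g
  lift-ofSeq {g} g-per = mk≋ λ i → begin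
    toℕ (g (toℕ (i mod N)) mod p) % p ≡⟨ cong (_% p) (toℕ-mod _) ⟩
    g (toℕ (i mod N)) % p % p         ≡⟨ m%n%n≡m%n _ p ⟩
    g (toℕ (i mod N)) % p             ≡⟨ cong (λ k → g k % p) (toℕ-mod i) ⟩
    g (i % N) % p                     ≡⟨ cong (_% p) (periodic-% g-per i) ⟩
    g i % p                           ∎
    where open ≡-Reasoning

  toℕ-iterT : ∀ (a : State p N) m j → toℕ (iterT m a j) ≡ Δ^ 1 m (lift a) (toℕ j) % p
  toℕ-iterT a zero    j = begin
    toℕ (a j)
      ≡⟨ cong (toℕ ∘ a) (toℕ-injective (trans (toℕ-mod (toℕ j)) (m<n⇒m%n≡m (toℕ<n j)))) ⟨
    toℕ (a (toℕ j mod N))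
      ≡⟨ m<n⇒m%n≡m (toℕ<n (a (toℕ j mod N))) ⟨
    toℕ (a (toℕ j mod N)) % p ∎
    where open ≡-Reasoning
  toℕ-iterT a (suc m) j = begin
    toℕ (T (iterT m a) j)
      ≡⟨ toℕ-T (iterT m a) j ⟩
    (toℕ (iterT m a j) + toℕ (iterT m a (next j))) % p
      ≡⟨ cong₂ (λ x y → (x + y) % p) (toℕ-iterT a m j) (toℕ-iterT a m (next j)) ⟩
    (G (toℕ j) % p + G (toℕ (next j)) % p) % p
      ≡⟨ cong (λ k → (G (toℕ j) % p + G k % p) % p) (toℕ-next j) ⟩
    (G (toℕ j) % p + G (suc (toℕ j) % N) % p) % p
      ≡⟨ cong (λ k → (G (toℕ j) % p + k % p) % p) (trans (periodic-% G-periodic _) (cong G (+-comm 1 (toℕ j)))) ⟩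
    (G (toℕ j) % p + G (toℕ j + 1) % p) % p
      ≡⟨ %-distribˡ-+ (G (toℕ j)) _ p ⟨
    (G (toℕ j) + G (toℕ j + 1)) % p ∎
    where
    open ≡-Reasoning
    G = Δ^ 1 m (lift a)
    G-periodic : Periodic N G
    G-periodic = Δ^-periodic 1 m (lift-periodic a)

  Δ^-lift : ∀ a m x → Δ^ 1 m (lift a) x % p ≡ toℕ (iterT m a (x mod N))
  Δ^-lift a m x = begin
    Δ^ 1 m (lift a) x % p
      ≡⟨ cong (_% p) (periodic-% (Δ^-periodic 1 m (lift-periodic a)) x) ⟨
    Δ^ 1 m (lift a) (x % N) % p
      ≡⟨ cong (λ k → Δ^ 1 m (lift a) k % p) (toℕ-mod x) ⟨
    Δ^ 1 m (lift a) (toℕ (x mod N)) % p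
      ≡⟨ toℕ-iterT a m (x mod N) ⟨
    toℕ (iterT m a (x mod N)) ∎
    where open ≡-Reasoning

  iterT≈⇒Δ^≋ : ∀ a m m′ → iterT m a ≈ iterT m′ a → Δ^ 1 m (lift a) ≋ Δ^ 1 m′ (lift a)
  iterT≈⇒Δ^≋ a m m′ eq = mk≋ λ x →
    trans (Δ^-lift a m x) (trans (cong toℕ (eq (x mod N))) (sym (Δ^-lift a m′ x)))

  Δ^≋⇒iterT≈ : ∀ a m m′ → Δ^ 1 m (lift a) ≋ Δ^ 1 m′ (lift a) → iterT m a ≈ iterT m′ a
  Δ^≋⇒iterT≈ a m m′ eq j = toℕ-injective
    (trans (toℕ-iterT a m j) (trans (at eq (toℕ j)) (sym (toℕ-iterT a m′ j))))

  eventuallyPeriodic⇒Δ : ∀ a P → EventuallyPeriodic a P → EventuallyPeriodicΔ (lift a) P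
  eventuallyPeriodic⇒Δ a P (K , period) = K , λ k K≤k → iterT≈⇒Δ^≋ a (k + P) k (period k K≤k)

  Δ⇒eventuallyPeriodic : ∀ a P → EventuallyPeriodicΔ (lift a) P → EventuallyPeriodic a P
  Δ⇒eventuallyPeriodic a P (K , period) = K , λ k K≤k → Δ^≋⇒iterT≈ a (k + P) k (period k K≤k)

  isPeriod : ∀ {L} → 0 < L → (∀ g → Periodic N g → EventuallyPeriodicΔ g L) →
    ∀ g → Periodic N g → (∀ Q → 0 < Q → Q < L → ¬ EventuallyPeriodicΔ g Q) → IsPeriod p N L
  isPeriod {L} 0<L period-L g g-periodic g-minimal = (ofSeq g , 0<L , cycle-L (ofSeq g) , ofSeq-minimal) , bound
    where
    cycle-L : ∀ a → EventuallyPeriodic a L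
    cycle-L a = Δ⇒eventuallyPeriodic a L (period-L (lift a) (lift-periodic a))
    ofSeq-minimal : ∀ Q → 0 < Q → Q < L → ¬ EventuallyPeriodic (ofSeq g) Q
    ofSeq-minimal Q 0<Q Q<L cycle = g-minimal Q 0<Q Q<L
      (eventuallyPeriodic-resp (lift-ofSeq g-periodic) (eventuallyPeriodic⇒Δ (ofSeq g) Q cycle))
    bound : ∀ a c → IsCycleLength a c → c ≤ L
    bound a c (_ , _ , c-minimal) = ≮⇒≥ λ L<c → c-minimal L 0<L L<c (cycle-L a)

-- The two period computations

m+m≤m*n : ∀ m {n} → 2 ≤ n → m + m ≤ m * n
m+m≤m*n m {n} 2≤n = begin
  m + m        ≡⟨ cong (m +_) (*-identityʳ m) ⟨
  m + m * 1    ≡⟨ *-suc m 1 ⟨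
  m * 2        ≤⟨ *-monoʳ-≤ m 2≤n ⟩
  m * n        ∎
  where open ≤-Reasoning

m+m*[n∸1]≡m*n : ∀ m {n} → 1 ≤ n → m + m * (n ∸ 1) ≡ m * n
m+m*[n∸1]≡m*n m {suc n} _ = sym (*-suc m n)

n*n∸1≡[n∸1]*[n+1] : ∀ n → n * n ∸ 1 ≡ (n ∸ 1) * (n + 1)
n*n∸1≡[n∸1]*[n+1] zero    = refl
n*n∸1≡[n∸1]*[n+1] (suc n) = lemma n
  where
  lemma : ∀ n → n + n * suc n ≡ n * (suc n + 1)
  lemma = solve-∀

[n+1]∣a*n⇒[n+1]∣a : ∀ n a → n + 1 ∣ a * n → n + 1 ∣ a
[n+1]∣a*n⇒[n+1]∣a n a = ∣m+n∣m⇒∣n (subst (n + 1 ∣_) a*[n+1]≡a*n+a (n∣m*n a))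
  where
  a*[n+1]≡a*n+a : a * (n + 1) ≡ a * n + a
  a*[n+1]≡a*n+a = trans (*-distribˡ-+ a n 1) (cong (a * n +_) (*-identityʳ a))

module Period-pᵏ[pⁿ∸1] {p} (p-prime : Prime p) (k n : ℕ) (3≤p^n : 3 ≤ p ^ n) where

  private instance
    p-nonTrivial : NonTrivial p
    p-nonTrivial = prime⇒nonTrivial p-prime
    p≢0 : NonZero p
    p≢0 = prime⇒nonZero p-prime

  open Congruence p
  open Frobenius p-prime

  u N : ℕ
  u = p ^ k
  N = p ^ k * (p ^ n ∸ 1)

  u+u≤N : u + u ≤ N
  u+u≤N = m+m≤m*n u (∸-monoˡ-≤ 1 3≤p^n)

  private instance
    N≢0 : NonZero N
    N≢0 = >-nonZero (<-≤-trans (m^n>0 p k) (≤-trans (m≤m+n u u) u+u≤N))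

  u+N≡p^[k+n] : u + N ≡ p ^ (k + n)
  u+N≡p^[k+n] = trans (m+m*[n∸1]≡m*n u (m^n>0 p n)) (sym (^-distribˡ-+-* p k n))

  periodicFrom-N : ∀ {g} → Periodic N g → PeriodicFrom u g N
  periodicFrom-N = periodicFrom-^ k (k + n) u+N≡p^[k+n]

  half-period : ∀ {Q} → 0 < Q → Q < N → PeriodicFrom u (pulse N) Q →
    Σ ℕ λ Q′ → 0 < Q′ × Q′ + Q′ ≤ N × PeriodicFrom u (pulse N) Q′
  half-period {Q} 0<Q Q<N periodQ with Q + Q ≤? N
  ... | yes 2Q≤N = Q , 0<Q , 2Q≤N , periodQ
  ... | no  2Q≰N = N ∸ Q , m<n⇒0<n∸m Q<N , 2[N∸Q]≤N ,
    periodicFrom-∸ {u} {pulse N} {N} {Q} (periodicFrom-N pulse-periodic) periodQ (<⇒≤ Q<N)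
    where
    N∸Q≤Q : N ∸ Q ≤ Q
    N∸Q≤Q = subst (N ∸ Q ≤_) (m+n∸n≡m Q Q) (∸-monoˡ-≤ Q (<⇒≤ (≰⇒> 2Q≰N)))
    2[N∸Q]≤N : N ∸ Q + (N ∸ Q) ≤ N
    2[N∸Q]≤N = subst (N ∸ Q + (N ∸ Q) ≤_) (m∸n+n≡m (<⇒≤ Q<N)) (+-monoʳ-≤ (N ∸ Q) N∸Q≤Q)

  no-shorter-cycle : ∀ Q → 0 < Q → Q < N → ¬ EventuallyPeriodicΔ (pulse N) Q
  no-shorter-cycle Q 0<Q Q<N cycle with half-period 0<Q Q<N
    (eventuallyPeriodic⇒periodicFrom {u} {pulse N} {N} {Q} (>-nonZero⁻¹ N) (periodicFrom-N pulse-periodic) cycle)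
  ... | Q′ , 0<Q′ , 2Q′≤N , periodQ′ = Δ^-pulse-injective (m<m+n u 0<Q′) (sum≤ {u} {Q′} {N} u+u≤N 2Q′≤N) periodQ′
    where
    sum≤ : ∀ {a b c} → a + a ≤ c → b + b ≤ c → a + b ≤ c
    sum≤ {a} {b} 2a≤c 2b≤c with ≤-total a b
    ... | inj₁ a≤b = ≤-trans (+-monoˡ-≤ b a≤b) 2b≤c
    ... | inj₂ b≤a = ≤-trans (+-monoʳ-≤ a b≤a) 2a≤c

  isPeriod-N : IsPeriod p N N
  isPeriod-N = isPeriod (>-nonZero⁻¹ N)
    (λ g g-periodic → u , periodicFrom⇒eventuallyPeriodic {u} {g} {N} (periodicFrom-N g-periodic))
    (pulse N) pulse-periodic no-shorter-cycle

module Period-pᵏ[pⁿ+1] {p} (p-prime : Prime p) (k n : ℕ) (1≤n : 1 ≤ n) where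

  private instance
    p-nonTrivial : NonTrivial p
    p-nonTrivial = prime⇒nonTrivial p-prime
    p≢0 : NonZero p
    p≢0 = prime⇒nonZero p-prime

  open Congruence p
  open Frobenius p-prime

  u x e N L D : ℕ
  u = p ^ k
  x = p ^ n
  e = p ^ (k + n)
  N = p ^ k * (p ^ n + 1)
  L = p ^ k * (p ^ (2 * n) ∸ 1)
  D = u * (x ∸ 1)

  0<u : 0 < u
  0<u = m^n>0 p k

  2≤x : 2 ≤ x
  2≤x = ≤-trans (subst (2 ≤_) (sym (*-identityʳ p)) (nonTrivial⇒n>1 p)) (^-monoʳ-≤ p 1≤n)

  private instance
    u≢0 : NonZero u
    u≢0 = >-nonZero 0<u
    N≢0 : NonZero N
    N≢0 = m*n≢0 u (x + 1) {{u≢0}} {{>-nonZero (m≤n+m 1 x)}}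

  0<D : 0 < D
  0<D = >-nonZero⁻¹ D {{m*n≢0 u (x ∸ 1) {{u≢0}} {{>-nonZero (∸-monoˡ-≤ 1 2≤x)}}}}

  e≡u*x : e ≡ u * x
  e≡u*x = ^-distribˡ-+-* p k n

  u+e≡N : u + e ≡ N
  u+e≡N = begin
    u + e            ≡⟨ cong (u +_) e≡u*x ⟩
    u + u * x        ≡⟨ +-comm u (u * x) ⟩
    u * x + u        ≡⟨ cong (u * x +_) (*-identityʳ u) ⟨
    u * x + u * 1    ≡⟨ *-distribˡ-+ u x 1 ⟨
    N                ∎
    where open ≡-Reasoning

  u+D≡e : u + D ≡ e
  u+D≡e = trans (m+m*[n∸1]≡m*n u (<-≤-trans z<s 2≤x)) (sym e≡u*x)

  p^[2n]≡x*x : p ^ (2 * n) ≡ x * x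
  p^[2n]≡x*x = trans (cong (p ^_) (cong (n +_) (+-identityʳ n))) (^-distribˡ-+-* p n n)

  L≡u*[[x∸1]*[x+1]] : L ≡ u * ((x ∸ 1) * (x + 1))
  L≡u*[[x∸1]*[x+1]] = trans (cong (λ y → u * (y ∸ 1)) p^[2n]≡x*x) (cong (u *_) (n*n∸1≡[n∸1]*[n+1] x))

  L≡[x∸1]*N : L ≡ (x ∸ 1) * N
  L≡[x∸1]*N = trans L≡u*[[x∸1]*[x+1]] (rearrange u (x ∸ 1) (x + 1))
    where
    rearrange : ∀ a b c → a * (b * c) ≡ b * (a * c)
    rearrange = solve-∀

  L≡[x+1]*D : L ≡ (x + 1) * D
  L≡[x+1]*D = trans L≡u*[[x∸1]*[x+1]] (rearrange u (x ∸ 1) (x + 1))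
    where
    rearrange : ∀ a b c → a * (b * c) ≡ c * (a * b)
    rearrange = solve-∀

  u+L≡p^[k+2n] : u + L ≡ p ^ (k + 2 * n)
  u+L≡p^[k+2n] = trans (m+m*[n∸1]≡m*n u (m^n>0 p (2 * n))) (sym (^-distribˡ-+-* p k (2 * n)))

  periodicFrom-L : ∀ {g} → Periodic N g → PeriodicFrom u g L
  periodicFrom-L {g} g-periodic = periodicFrom-^ k (k + 2 * n) u+L≡p^[k+2n]
    (subst (λ M → Periodic M g) (sym L≡[x∸1]*N) (periodic-* g-periodic (x ∸ 1)))

  orbit : ℕ → Seq
  orbit j = Δ^ 1 j (pulse N)

  rotation : orbit (u + D) ≋ shift e (orbit u)
  rotation = begin
    orbit (u + D)            ≡⟨ cong orbit u+D≡e ⟩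
    orbit e                  ≈⟨ frobenius-^₁ (k + n) (pulse N) ⟩
    Δ e (pulse N)            ≈⟨ ≡⇒≋ (Δ-complement pulse-periodic u+e≡N) ⟩
    shift e (Δ u (pulse N))  ≈⟨ shift-cong e (frobenius-^₁ k (pulse N)) ⟨
    shift e (orbit u)        ∎
    where open import Relation.Binary.Reasoning.Setoid ≋-setoid

  module _ {Q} (0<Q : 0 < Q) (Q<L : Q < L) (cycle : EventuallyPeriodicΔ (pulse N) Q) where

    private instance
      D≢0 : NonZero D
      D≢0 = >-nonZero 0<D

    a r t : ℕ
    a = Q / D
    r = Q % D
    t = (a * e) % N

    Q≡r+a*D : Q ≡ r + a * D
    Q≡r+a*D = m≡m%n+[m/n]*n Q D

    u+r<e : u + r < e
    u+r<e = subst (u + r <_) u+D≡e (+-monoʳ-< u (m%n<n Q D))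

    periodQ : PeriodicFrom u (pulse N) Q
    periodQ = eventuallyPeriodic⇒periodicFrom {u} {pulse N} {L} {Q} (<-trans 0<Q Q<L) (periodicFrom-L pulse-periodic) cycle

    rotated : shift t (orbit (u + r)) ≋ Δ u (pulse N)
    rotated = begin
      shift t (orbit (u + r))
        ≈⟨ ≡⇒≋ (periodic-shift-% (Δ^-periodic 1 (u + r) pulse-periodic) (a * e)) ⟨
      shift (a * e) (orbit (u + r))
        ≈⟨ shiftedFrom-* {u} {pulse N} {D} {e} rotation a r ⟨
      orbit (u + r + a * D)
        ≡⟨ cong orbit (trans (+-assoc u r (a * D)) (cong (u +_) (sym Q≡r+a*D))) ⟩
      orbit (u + Q)
        ≈⟨ periodQ ⟩
      orbit u
        ≈⟨ frobenius-^₁ k (pulse N) ⟩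
      Δ u (pulse N) ∎
      where open import Relation.Binary.Reasoning.Setoid ≋-setoid

    e<N : e < N
    e<N = subst (e <_) u+e≡N (m<n+m e 0<u)

    a<x+1 : a < x + 1
    a<x+1 = *-cancelʳ-< D a (x + 1) (begin-strict
      a * D          ≤⟨ m≤n+m (a * D) r ⟩
      r + a * D      ≡⟨ Q≡r+a*D ⟨
      Q              <⟨ Q<L ⟩
      L              ≡⟨ L≡[x+1]*D ⟩
      (x + 1) * D    ∎)
      where open ≤-Reasoning

    x+1∣a : t ≡ 0 → x + 1 ∣ a
    x+1∣a t≡0 = [n+1]∣a*n⇒[n+1]∣a x a (*-cancelˡ-∣ u (subst (N ∣_) a*e≡u*[a*x] (m%n≡0⇒n∣m (a * e) N t≡0)))
      where
      a*e≡u*[a*x] : a * e ≡ u * (a * x)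
      a*e≡u*[a*x] = trans (cong (a *_) e≡u*x) (rearrange a u x)
        where
        rearrange : ∀ a b c → a * (b * c) ≡ b * (a * c)
        rearrange = solve-∀

    cycle-impossible : ⊥
    cycle-impossible with t ≟ 0 | r ≟ 0
    ... | no t≢0  | _       =
      shift-Δ^-pulse≉Δ u+e≡N 0<u (m≤m+n u r) u+r<e (n≢0⇒n>0 t≢0) (m%n<n (a * e) N) rotated
    ... | yes t≡0 | no r≢0  =
      Δ^-pulse≉Δ (m<m+n u (n≢0⇒n>0 r≢0)) (<-trans u+r<e e<N) (≋-trans (≡⇒≋ unshift) rotated)
      where
      unshift : ∀ i → orbit (u + r) i ≡ shift t (orbit (u + r)) i
      unshift i = trans (cong (orbit (u + r)) (sym (+-identityʳ i))) (cong (λ s → orbit (u + r) (i + s)) (sym t≡0))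
    ... | yes t≡0 | yes r≡0 = <⇒≱ a<x+1 (∣⇒≤ {{>-nonZero 0<a}} (x+1∣a t≡0))
      where
      0<a : 0 < a
      0<a = n≢0⇒n>0 λ a≡0 → <⇒≢ 0<Q (sym (trans Q≡r+a*D (cong₂ (λ r a → r + a * D) r≡0 a≡0)))

  no-shorter-cycle : ∀ Q → 0 < Q → Q < L → ¬ EventuallyPeriodicΔ (pulse N) Q
  no-shorter-cycle Q 0<Q Q<L = cycle-impossible 0<Q Q<L

  isPeriod-L : IsPeriod p N L
  isPeriod-L = isPeriod 0<L
    (λ g g-periodic → u , periodicFrom⇒eventuallyPeriodic {u} {g} {L} (periodicFrom-L g-periodic))
    (pulse N) pulse-periodic no-shorter-cycle
    where
    0<L : 0 < L
    0<L = subst (0 <_) (sym L≡[x+1]*D) (>-nonZero⁻¹ _ {{m*n≢0 (x + 1) D {{>-nonZero (m≤n+m 1 x)}} {{>-nonZero 0<D}}}})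

3≤p^n : ∀ {p n} → Prime p → 1 ≤ n → (p ≡ 2 → 2 ≤ n) → 3 ≤ p ^ n
3≤p^n {p} {n} p-prime 1≤n p≡2⇒2≤n with p ≟ 2
... | yes refl = ≤-trans (n≤1+n 3) (^-monoʳ-≤ 2 (p≡2⇒2≤n refl))
... | no  p≢2  = ≤-trans 3≤p (subst (_≤ p ^ n) (*-identityʳ p) (^-monoʳ-≤ p {{prime⇒nonZero p-prime}} 1≤n))
  where
  3≤p : 3 ≤ p
  3≤p = ≤∧≢⇒< (nonTrivial⇒n>1 p {{prime⇒nonTrivial p-prime}}) (p≢2 ∘ sym)

proposition7p4 : ∀ (p k n : ℕ) → Prime p → 1 ≤ n → (p ≡ 2 → 2 ≤ n) →
    IsPeriod p (p ^ k * (p ^ n ∸ 1)) (p ^ k * (p ^ n ∸ 1))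
    × IsPeriod p (p ^ k * (p ^ n + 1)) (p ^ k * (p ^ (2 * n) ∸ 1))
proposition7p4 p k n p-prime 1≤n p≡2⇒2≤n =
  Period-pᵏ[pⁿ∸1].isPeriod-N p-prime k n (3≤p^n p-prime 1≤n p≡2⇒2≤n) , Period-pᵏ[pⁿ+1].isPeriod-L p-prime k n 1≤n
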